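{- Let $\sigma\approx\tau$ be one of the isomorphisms $\sigma'\wedge\sigma'\approx\sigma'$, $\sigma'\vee\sigma'\approx\sigma'$, $\sigma'\wedge\tau'\approx\tau'\wedge\sigma'$, $\sigma'\vee\tau'\approx\tau'\vee\sigma'$, $(\sigma'\wedge\tau')\wedge\rho'\approx\sigma'\wedge(\tau'\wedge\rho')$, $(\sigma'\vee\tau')\vee\rho'\approx\sigma'\vee(\tau'\vee\rho')$ (idempotence, commutativity, associativity). If $d(C[\,])$ is defined, then $C[\sigma]\approx C[\tau]$.
   Context: Types: $\sigma ::= \varphi \mid \sigma\to\sigma \mid \sigma\wedge\sigma \mid \sigma\vee\sigma$ ($\varphi$ atomic). Typing of linear $\lambda$-terms: (Ax) $x:\sigma\vdash x:\sigma$; ($\to$I) from $\Gamma,x:\sigma\vdash M:\tau$ infer $\Gamma\vdash\lambda x.M:\sigma\to\tau$; ($\to$E) from $\Gamma_1\vdash M:\sigma\to\tau$, $\Gamma_2\vdash N:\sigma$ infer $\Gamma_1,\Gamma_2\vdash MN:\tau$ (disjoint environments); ($\wedge$I) from $\Gamma\vdash M:\sigma$, $\Gamma\vdash M:\tau$ infer $\Gamma\vdash M:\sigma\wedge\tau$; ($\wedge$E) from $\Gamma\vdash M:\sigma\wedge\tau$ infer $\Gamma\vdash M:\sigma$ and $\Gamma\vdash M:\tau$; ($\vee$I) from $\Gamma\vdash M:\sigma$ infer $\Gamma\vdash M:\sigma\vee\tau$ and $\Gamma\vdash M:\tau\vee\sigma$; ($\vee$E) from $\Gamma_1,x:\sigma\wedge\theta\vdash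 M:\rho$, $\Gamma_1,x:\tau\wedge\theta\vdash M:\rho$, $\Gamma_2\vdash N:(\sigma\vee\tau)\wedge\theta$ infer $\Gamma_1,\Gamma_2\vdash M[N/x]:\rho$. A finite hereditary permutator (FHP) is a $\lambda$-term which modulo $\beta$ has the form $\lambda xy_1\dots y_n.x(P_1y_{\pi(1)})\dots(P_ny_{\pi(n)})$ ($n\ge0$), $\pi$ a permutation, $P_i$ FHPs. $\sigma\approx\tau$ iff there are FHPs $P,P'$, inverse of each other (i.e. $\lambda x.P(P'x)$ and $\lambda x.P'(Px)$ $\beta\eta$-equal to $\lambda x.x$), with $\vdash P:\sigma\to\tau$, $\vdash P':\tau\to\sigma$. Contexts $C[\,]::=[\,]\mid C[\,]\to\sigma\mid\sigma\to C[\,]\mid\sigma\wedge C[\,]\mid C[\,]\wedge\sigma\mid\sigma\vee C[\,]\mid C[\,]\vee\sigma$. d-paths are strings over $\{\swarrow,\searrow\}$. Agreement: every type agrees with $\epsilon$; $\tau\to\rho$ agrees with $\swarrow p$ (resp. $\searrow p$) if $\tau$ (resp. $\rho$) agrees with $p$; $\tau\wedge\rho$, $\tau\vee\rho$ agree with $p$ if both components do. The d-path of a context: $d([\,])=\epsilon$; $d(C'\to\sigma)=\swarrow d(C')$; $d(\sigma\to C')=\searrow d(C')$; $d(C'\wedge\sigma)=d(\sigma\wedge C')=d(C'\vee\sigma)=d(\sigma\vee C')=d(C')$ provided $\sigma$ agrees with $d(C')$; otherwise undefined. -}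

module Defs where

open import Data.Nat using (ℕ; zero; suc; _+_; _∸_; _<ᵇ_; _≡ᵇ_)
open import Data.Bool using (Bool; true; false; if_then_else_)
open import Data.Fin using (Fin; toℕ; opposite)
open import Data.Fin.Permutation using (Permutation′; _⟨$⟩ʳ_)
open import Data.List using (List; []; _∷_)
open import Data.Maybe using (Maybe; just; nothing)
open import Data.Product using (Σ; _×_; _,_)
open import Data.List.Relation.Unary.All using (All)
open import Relation.Binary.PropositionalEquality using (_≡_)

infixr 7 _⇒_
infixr 8 _∨_
infixr 9 _∧_

data Ty : Set where
  atom : ℕ → Ty
  _⇒_  : Ty → Ty → Ty
  _∧_  : Ty → Ty → Ty
  _∨_  : Ty → Ty → Ty

data Term : Set where
  var : ℕ → Term
  lam : Term → Term
  app : Term → Term → Term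

shift : ℕ → ℕ → Term → Term
shift d c (var i) = if i <ᵇ c then var i else var (i + d)
shift d c (lam t) = lam (shift d (suc c) t)
shift d c (app t u) = app (shift d c t) (shift d c u)

subst : ℕ → Term → Term → Term
subst j N (var i) =
  if i ≡ᵇ j then N else (if j <ᵇ i then var (i ∸ 1) else var i)
subst j N (lam t) = lam (subst (suc j) (shift 1 0 N) t)
subst j N (app t u) = app (subst j N t) (subst j N u)

_[_]₀ : Term → Term → Term
M [ N ]₀ = subst 0 N M

data _=β_ : Term → Term → Set where
  β      : ∀ M N → app (lam M) N =β (M [ N ]₀)
  reflβ  : ∀ {M} → M =β M
  symβ   : ∀ {M N} → M =β N → N =β M
  transβ : ∀ {M N K} → M =β N → N =β K → M =β K
  lamβ   : ∀ {M N} → M =β N → lam M =β lam N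
  appβ   : ∀ {M M' N N'} → M =β M' → N =β N' → app M N =β app M' N'

data _=βη_ : Term → Term → Set where
  β       : ∀ M N → app (lam M) N =βη (M [ N ]₀)
  η       : ∀ M → lam (app (shift 1 0 M) (var 0)) =βη M
  reflβη  : ∀ {M} → M =βη M
  symβη   : ∀ {M N} → M =βη N → N =βη M
  transβη : ∀ {M N K} → M =βη N → N =βη K → M =βη K
  lamβη   : ∀ {M N} → M =βη N → lam M =βη lam N
  appβη   : ∀ {M M' N N'} → M =βη M' → N =βη N' → app M N =βη app M' N'

-- Environments: position i of the list is the type of de Bruijn index i
-- (nothing = variable not in the environment).

Env : Set
Env = List (Maybe Ty)

Empty : Env → Set
Empty Γ = All (_≡ nothing) Γ

data Only : ℕ → Ty → Env → Set where
  here  : ∀ {σ Γ} → Empty Γ → Only zero σ (just σ ∷ Γ)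
  there : ∀ {i σ Γ} → Only i σ Γ → Only (suc i) σ (nothing ∷ Γ)

data Split : Env → Env → Env → Set where
  []  : Split [] [] []
  n∷_ : ∀ {Γ Γ₁ Γ₂} → Split Γ Γ₁ Γ₂ → Split (nothing ∷ Γ) (nothing ∷ Γ₁) (nothing ∷ Γ₂)
  l∷_ : ∀ {σ Γ Γ₁ Γ₂} → Split Γ Γ₁ Γ₂ → Split (just σ ∷ Γ) (just σ ∷ Γ₁) (nothing ∷ Γ₂)
  r∷_ : ∀ {σ Γ Γ₁ Γ₂} → Split Γ Γ₁ Γ₂ → Split (just σ ∷ Γ) (nothing ∷ Γ₁) (just σ ∷ Γ₂)

infix 4 _⊢_∶_

data _⊢_∶_ : Env → Term → Ty → Set where
  ax   : ∀ {Γ i σ} → Only i σ Γ → Γ ⊢ var i ∶ σ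
  ⇒I   : ∀ {Γ M σ τ} → (just σ ∷ Γ) ⊢ M ∶ τ → Γ ⊢ lam M ∶ σ ⇒ τ
  ⇒E   : ∀ {Γ Γ₁ Γ₂ M N σ τ} → Split Γ Γ₁ Γ₂ →
         Γ₁ ⊢ M ∶ σ ⇒ τ → Γ₂ ⊢ N ∶ σ → Γ ⊢ app M N ∶ τ
  ∧I   : ∀ {Γ M σ τ} → Γ ⊢ M ∶ σ → Γ ⊢ M ∶ τ → Γ ⊢ M ∶ σ ∧ τ
  ∧El  : ∀ {Γ M σ τ} → Γ ⊢ M ∶ σ ∧ τ → Γ ⊢ M ∶ σ
  ∧Er  : ∀ {Γ M σ τ} → Γ ⊢ M ∶ σ ∧ τ → Γ ⊢ M ∶ τ
  ∨Il  : ∀ {Γ M σ τ} → Γ ⊢ M ∶ σ → Γ ⊢ M ∶ σ ∨ τ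
  ∨Ir  : ∀ {Γ M σ τ} → Γ ⊢ M ∶ σ → Γ ⊢ M ∶ τ ∨ σ
  ∨E   : ∀ {Γ Γ₁ Γ₂ M N σ τ θ ρ} → Split Γ Γ₁ Γ₂ →
         (just (σ ∧ θ) ∷ Γ₁) ⊢ M ∶ ρ →
         (just (τ ∧ θ) ∷ Γ₁) ⊢ M ∶ ρ →
         Γ₂ ⊢ N ∶ (σ ∨ τ) ∧ θ →
         Γ ⊢ M [ N ]₀ ∶ ρ

lams : ℕ → Term → Term
lams zero t = t
lams (suc n) t = lam (lams n t)

appsFin : ∀ {n} → Term → (Fin n → Term) → Term
appsFin {zero} h args = h
appsFin {suc n} h args =
  appsFin {n} (app h (args Fin.zero)) (λ i → args (Fin.suc i))

-- λ x y₁ … yₙ . x (P₁ y_π(1)) … (Pₙ y_π(n))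
-- under these n+1 binders: x = var n, y_(i+1) = var (n-1-i) = var (toℕ (opposite i))
fhpForm : (n : ℕ) → Permutation′ n → (Fin n → Term) → Term
fhpForm n π P =
  lams (suc n)
    (appsFin (var n)
      (λ i → app (shift (suc n) 0 (P i)) (var (toℕ (opposite (π ⟨$⟩ʳ i))))))

data FHP : Term → Set where
  fhp : ∀ {M} (n : ℕ) (π : Permutation′ n) (P : Fin n → Term) →
        (∀ i → FHP (P i)) → M =β fhpForm n π P → FHP M

compose : Term → Term → Term
compose P P' = lam (app (shift 1 0 P) (app (shift 1 0 P') (var 0)))

infix 4 _≈_
_≈_ : Ty → Ty → Set
σ ≈ τ = Σ Term λ P → Σ Term λ P' →
  FHP P × FHP P' ×
  ([] ⊢ P ∶ σ ⇒ τ) × ([] ⊢ P' ∶ τ ⇒ σ) ×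
  (compose P P' =βη lam (var 0)) × (compose P' P =βη lam (var 0))

data Ctx : Set where
  □     : Ctx
  _⇒ₗ_  : Ctx → Ty → Ctx
  _⇒ᵣ_  : Ty → Ctx → Ctx
  _∧ₗ_  : Ctx → Ty → Ctx
  _∧ᵣ_  : Ty → Ctx → Ctx
  _∨ₗ_  : Ctx → Ty → Ctx
  _∨ᵣ_  : Ty → Ctx → Ctx

_[_] : Ctx → Ty → Ty
□ [ ρ ] = ρ
(C ⇒ₗ σ) [ ρ ] = (C [ ρ ]) ⇒ σ
(σ ⇒ᵣ C) [ ρ ] = σ ⇒ (C [ ρ ])
(C ∧ₗ σ) [ ρ ] = (C [ ρ ]) ∧ σ
(σ ∧ᵣ C) [ ρ ] = σ ∧ (C [ ρ ])
(C ∨ₗ σ) [ ρ ] = (C [ ρ ]) ∨ σ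
(σ ∨ᵣ C) [ ρ ] = σ ∨ (C [ ρ ])

data Dir : Set where
  ↙ ↘ : Dir

DPath : Set
DPath = List Dir

data Agrees : Ty → DPath → Set where
  ε    : ∀ {σ} → Agrees σ []
  ↙⇒   : ∀ {τ ρ p} → Agrees τ p → Agrees (τ ⇒ ρ) (↙ ∷ p)
  ↘⇒   : ∀ {τ ρ p} → Agrees ρ p → Agrees (τ ⇒ ρ) (↘ ∷ p)
  ag∧  : ∀ {τ ρ p} → Agrees τ p → Agrees ρ p → Agrees (τ ∧ ρ) p
  ag∨  : ∀ {τ ρ p} → Agrees τ p → Agrees ρ p → Agrees (τ ∨ ρ) p

-- d C ≡ p  (the partial function d, as its graph)
data D : Ctx → DPath → Set where
  d□  : D □ []
  d⇒ₗ : ∀ {C σ p} → D C p → D (C ⇒ₗ σ) (↙ ∷ p)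
  d⇒ᵣ : ∀ {C σ p} → D C p → D (σ ⇒ᵣ C) (↘ ∷ p)
  d∧ₗ : ∀ {C σ p} → D C p → Agrees σ p → D (C ∧ₗ σ) p
  d∧ᵣ : ∀ {C σ p} → D C p → Agrees σ p → D (σ ∧ᵣ C) p
  d∨ₗ : ∀ {C σ p} → D C p → Agrees σ p → D (C ∨ₗ σ) p
  d∨ᵣ : ∀ {C σ p} → D C p → Agrees σ p → D (σ ∨ᵣ C) p

data BasicIso : Ty → Ty → Set where
  idem∧  : ∀ σ → BasicIso (σ ∧ σ) σ
  idem∨  : ∀ σ → BasicIso (σ ∨ σ) σ
  comm∧  : ∀ σ τ → BasicIso (σ ∧ τ) (τ ∧ σ)
  comm∨  : ∀ σ τ → BasicIso (σ ∨ τ) (τ ∨ σ)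
  assoc∧ : ∀ σ τ ρ → BasicIso ((σ ∧ τ) ∧ ρ) (σ ∧ (τ ∧ ρ))
  assoc∨ : ∀ σ τ ρ → BasicIso ((σ ∨ τ) ∨ ρ) (σ ∨ (τ ∨ ρ))

-- Both directions of C[σ] ≈ C[τ] are witnessed by one term ηid p, the identity
-- η-expanded along p = d(C): a ↘ adds an argument y passed on as I y, a ↙ adds one passed
-- on as (ηid q) y, where q is the rest of the path.  It is a finite hereditary permutator
-- with identity permutations and is βη-equal to λx.x, hence its own inverse.  The linear
-- system has no subsumption rule, but each basic isomorphism is an admissible subsumption
-- in both directions (for ∨ through ∨E), and ηid p lifts an admissible subsumption at the
-- end of p to the whole type, contravariantly under ↙.  The side types of C that p only
-- agrees with are expanded along p too and come out unchanged; agreement is exactly what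
-- lets one expansion type both components of a ∧ or ∨.
module Submission where

open import Defs
open import Data.Bool using (true; false)
open import Data.Fin using (Fin; toℕ; opposite) renaming (zero to fzero; suc to fsuc)
open import Data.Fin.Properties using (toℕ<n; toℕ-fromℕ; toℕ-inject₁)
import Data.Fin.Permutation as Permutation
open import Data.List using ([]; _∷_; _++_; replicate)
open import Data.List.Relation.Unary.All using ([]; _∷_)
open import Data.Maybe using (just; nothing)
open import Data.Nat using (ℕ; zero; suc; _+_; _<ᵇ_; _≡ᵇ_; _≤_; _<_; z≤n; s≤s)
open import Data.Nat.Properties
  using (+-assoc; +-suc; +-identityʳ; ≤-trans; m≤m+n; m<m+n; <⇒≤)
open import Data.Product using (∃; _×_; _,_)
open import Level using (0ℓ)
open import Relation.Binary.Bundles using (Setoid)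
open import Relation.Binary.PropositionalEquality
  using (_≡_; refl; sym; trans; cong; cong₂; module ≡-Reasoning) renaming (subst to ≡-subst)

<⇒<ᵇ≡true : ∀ {i c} → i < c → (i <ᵇ c) ≡ true
<⇒<ᵇ≡true {zero}  {suc c} _         = refl
<⇒<ᵇ≡true {suc i} {suc c} (s≤s i<c) = <⇒<ᵇ≡true i<c

≥⇒<ᵇ≡false : ∀ {i c} → c ≤ i → (i <ᵇ c) ≡ false
≥⇒<ᵇ≡false {i}     {zero}  _         = refl
≥⇒<ᵇ≡false {suc i} {suc c} (s≤s c≤i) = ≥⇒<ᵇ≡false c≤i

<ᵇ≡false⇒≥ : ∀ i c → (i <ᵇ c) ≡ false → c ≤ i
<ᵇ≡false⇒≥ i       zero    _  = z≤n
<ᵇ≡false⇒≥ (suc i) (suc c) eq = s≤s (<ᵇ≡false⇒≥ i c eq)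

<⇒≡ᵇ≡false : ∀ {i j} → i < j → (i ≡ᵇ j) ≡ false
<⇒≡ᵇ≡false {zero}  {suc j} _         = refl
<⇒≡ᵇ≡false {suc i} {suc j} (s≤s i<j) = <⇒≡ᵇ≡false i<j

≡ᵇ-refl : ∀ i → (i ≡ᵇ i) ≡ true
≡ᵇ-refl zero    = refl
≡ᵇ-refl (suc i) = ≡ᵇ-refl i

data Scoped : ℕ → Term → Set where
  var : ∀ {k i} → i < k → Scoped k (var i)
  lam : ∀ {k t} → Scoped (suc k) t → Scoped k (lam t)
  app : ∀ {k t u} → Scoped k t → Scoped k u → Scoped k (app t u)

Closed : Term → Set
Closed = Scoped 0

Scoped-mono : ∀ {k k′ t} → k ≤ k′ → Scoped k t → Scoped k′ t
Scoped-mono k≤k′ (var i<k) = var (≤-trans i<k k≤k′)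
Scoped-mono k≤k′ (lam s)   = lam (Scoped-mono (s≤s k≤k′) s)
Scoped-mono k≤k′ (app s u) = app (Scoped-mono k≤k′ s) (Scoped-mono k≤k′ u)

Closed⇒Scoped : ∀ {k t} → Closed t → Scoped k t
Closed⇒Scoped = Scoped-mono z≤n

shift-Scoped : ∀ {d c t} → Scoped c t → shift d c t ≡ t
shift-Scoped (var i<c) rewrite <⇒<ᵇ≡true i<c = refl
shift-Scoped (lam s)   = cong lam (shift-Scoped s)
shift-Scoped (app s u) = cong₂ app (shift-Scoped s) (shift-Scoped u)

subst-Scoped : ∀ {j N t} → Scoped j t → subst j N t ≡ t
subst-Scoped (var i<j) rewrite <⇒≡ᵇ≡false i<j | ≥⇒<ᵇ≡false (<⇒≤ i<j) = refl
subst-Scoped (lam s)   = cong lam (subst-Scoped s)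
subst-Scoped (app s u) = cong₂ app (subst-Scoped s) (subst-Scoped u)

shift-zero : ∀ c t → shift 0 c t ≡ t
shift-zero c (var i) with i <ᵇ c
... | true  = refl
... | false = cong var (+-identityʳ i)
shift-zero c (lam t)   = cong lam (shift-zero (suc c) t)
shift-zero c (app t u) = cong₂ app (shift-zero c t) (shift-zero c u)

shift-shift : ∀ a b c t → shift a c (shift b c t) ≡ shift (b + a) c t
shift-shift a b c (var i) with i <ᵇ c in i<ᵇc
... | true rewrite i<ᵇc = refl
... | false rewrite ≥⇒<ᵇ≡false (≤-trans (<ᵇ≡false⇒≥ i c i<ᵇc) (m≤m+n i b)) =
  cong var (+-assoc i b a)
shift-shift a b c (lam t)   = cong lam (shift-shift a b (suc c) t)
shift-shift a b c (app t u) = cong₂ app (shift-shift a b c t) (shift-shift a b c u)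

appsFin-cong : ∀ {n h h′} {f g : Fin n → Term} →
               h ≡ h′ → (∀ i → f i ≡ g i) → appsFin h f ≡ appsFin h′ g
appsFin-cong {zero}  h≡h′ f≡g = h≡h′
appsFin-cong {suc n} h≡h′ f≡g =
  appsFin-cong {n} (cong₂ app h≡h′ (f≡g fzero)) (λ i → f≡g (fsuc i))

subst-appsFin : ∀ {n} j N h (f : Fin n → Term) →
                subst j N (appsFin h f) ≡ appsFin (subst j N h) (λ i → subst j N (f i))
subst-appsFin {zero}  j N h f = refl
subst-appsFin {suc n} j N h f = subst-appsFin {n} j N (app h (f fzero)) (λ i → f (fsuc i))

subst-lams : ∀ m j N t → subst j N (lams m t) ≡ lams m (subst (m + j) (shift m 0 N) t)
subst-lams zero    j N t = cong (λ N′ → subst j N′ t) (sym (shift-zero 0 N))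
subst-lams (suc m) j N t = cong lam (trans (subst-lams m (suc j) (shift 1 0 N) t)
  (cong₂ (λ j′ N′ → lams m (subst j′ N′ t)) (+-suc m j) (shift-shift m 1 0 N)))

Scoped-lams : ∀ m {k t} → Scoped (m + k) t → Scoped k (lams m t)
Scoped-lams zero    s = s
Scoped-lams (suc m) {k} {t} s =
  lam (Scoped-lams m (≡-subst (λ k′ → Scoped k′ t) (sym (+-suc m k)) s))

Scoped-appsFin : ∀ {n k h} {f : Fin n → Term} →
                 Scoped k h → (∀ i → Scoped k (f i)) → Scoped k (appsFin h f)
Scoped-appsFin {zero}  sh sf = sh
Scoped-appsFin {suc n} sh sf = Scoped-appsFin {n} (app sh (sf fzero)) (λ i → sf (fsuc i))

I : Term
I = lam (var 0)

arity : DPath → ℕ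
arity []      = 0
arity (↙ ∷ _) = 1
arity (↘ ∷ p) = suc (arity p)

-- h (P₁ y₁) … (Pₙ yₙ), with y₁ … yₙ the n innermost bound variables, outermost first.
applyExpanded : (n : ℕ) → Term → (Fin n → Term) → Term
applyExpanded n h P = appsFin h (λ i → app (P i) (var (toℕ (opposite i))))

mutual
  ηid : DPath → Term
  ηid p = lam (ηExpand p (var 0))

  -- h must not see the arity p new binders, hence the shift.
  ηExpand : DPath → Term → Term
  ηExpand p h = lams (arity p) (applyExpanded (arity p) (shift (arity p) 0 h) (expander p))

  expander : (p : DPath) → Fin (arity p) → Term
  expander (↙ ∷ p) _        = ηid p
  expander (↘ ∷ p) fzero    = I
  expander (↘ ∷ p) (fsuc i) = expander p i

mutual
  ηid-closed : ∀ p → Closed (ηid p)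
  ηid-closed p = lam (Scoped-lams (arity p) (Scoped-appsFin (var (m<m+n (arity p) (s≤s z≤n)))
    (λ i → app (Closed⇒Scoped (expander-closed p i))
                (var (≤-trans (toℕ<n (opposite i)) (m≤m+n (arity p) 1))))))

  expander-closed : ∀ p i → Closed (expander p i)
  expander-closed (↙ ∷ p) _        = ηid-closed p
  expander-closed (↘ ∷ p) fzero    = lam (var (s≤s z≤n))
  expander-closed (↘ ∷ p) (fsuc i) = expander-closed p i

subst-ηExpand : ∀ p N → subst 0 N (ηExpand p (var 0)) ≡ ηExpand p N
subst-ηExpand p N = begin
  subst 0 N (lams n body)                  ≡⟨ subst-lams n 0 N body ⟩
  lams n (subst (n + 0) N′ body)           ≡⟨ cong (λ j → lams n (subst j N′ body)) (+-identityʳ n) ⟩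
  lams n (subst n N′ body)                 ≡⟨ cong (lams n) (subst-appsFin n N′ (var n) arg) ⟩
  lams n (appsFin (subst n N′ (var n)) (λ i → subst n N′ (arg i)))
                                           ≡⟨ cong (lams n) (appsFin-cong subst-head subst-args) ⟩
  ηExpand p N                              ∎
  where
  open ≡-Reasoning
  n : ℕ
  n = arity p
  N′ : Term
  N′ = shift n 0 N
  arg : Fin n → Term
  arg i = app (expander p i) (var (toℕ (opposite i)))
  body : Term
  body = appsFin (var n) arg

  subst-head : subst n N′ (var n) ≡ N′
  subst-head rewrite ≡ᵇ-refl n = refl

  subst-args : ∀ i → subst n N′ (arg i) ≡ arg i
  subst-args i = subst-Scoped (app (Closed⇒Scoped (expander-closed p i)) (var (toℕ<n (opposite i))))

ηExpand-↘ : ∀ p h → ηExpand (↘ ∷ p) h ≡ lam (ηExpand p (app (shift 1 0 h) (app I (var 0))))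
ηExpand-↘ p h = cong lam (cong (lams (arity p)) (appsFin-cong
  (cong₂ app (sym (shift-shift (arity p) 1 0 h)) (cong (λ j → app I (var j)) (toℕ-fromℕ (arity p))))
  (λ i → cong (λ j → app (expander p i) (var j)) (toℕ-inject₁ (opposite i)))))

≡⇒=β : ∀ {M N} → M ≡ N → M =β N
≡⇒=β refl = reflβ

I-FHP : FHP I
I-FHP = fhp 0 Permutation.id (λ ()) (λ ()) reflβ

mutual
  ηid-FHP : ∀ p → FHP (ηid p)
  ηid-FHP p = fhp (arity p) Permutation.id (expander p) (expander-FHP p)
    (≡⇒=β (cong lam (cong (lams (arity p)) (appsFin-cong refl
      (λ i → cong₂ app (sym (shift-Scoped (Closed⇒Scoped (expander-closed p i)))) refl)))))

  expander-FHP : ∀ p i → FHP (expander p i)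
  expander-FHP (↙ ∷ p) _        = ηid-FHP p
  expander-FHP (↘ ∷ p) fzero    = I-FHP
  expander-FHP (↘ ∷ p) (fsuc i) = expander-FHP p i

βη-setoid : Setoid 0ℓ 0ℓ
βη-setoid = record
  { Carrier       = Term
  ; _≈_           = _=βη_
  ; isEquivalence = record { refl = reflβη ; sym = symβη ; trans = transβη }
  }

ηid=βηI : ∀ p → ηid p =βη I
ηid=βηI []      = reflβη
ηid=βηI (↙ ∷ p) = begin
  lam (lam (app (var 1) (app (ηid p) (var 0))))  ≈⟨ lamβη (lamβη (appβη reflβη (appβη (ηid=βηI p) reflβη))) ⟩
  lam (lam (app (var 1) (app I (var 0))))        ≈⟨ lamβη (lamβη (appβη reflβη (β (var 0) (var 0)))) ⟩
  lam (lam (app (var 1) (var 0)))                ≈⟨ lamβη (η (var 0)) ⟩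
  I                                              ∎
  where open import Relation.Binary.Reasoning.Setoid βη-setoid
ηid=βηI (↘ ∷ p) = begin
  ηid (↘ ∷ p)                               ≡⟨ cong lam (ηExpand-↘ p (var 0)) ⟩
  lam (lam (ηExpand p x₁Ix₀))               ≡⟨ cong (λ t → lam (lam t)) (sym (subst-ηExpand p x₁Ix₀)) ⟩
  lam (lam (ηExpand p (var 0) [ x₁Ix₀ ]₀))  ≈⟨ lamβη (lamβη (symβη (β (ηExpand p (var 0)) x₁Ix₀))) ⟩
  lam (lam (app (ηid p) x₁Ix₀))             ≈⟨ lamβη (lamβη (appβη (ηid=βηI p) reflβη)) ⟩
  lam (lam (app I x₁Ix₀))                   ≈⟨ lamβη (lamβη (β (var 0) x₁Ix₀)) ⟩
  lam (lam x₁Ix₀)                           ≈⟨ lamβη (lamβη (appβη reflβη (β (var 0) (var 0)))) ⟩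
  lam (lam (app (var 1) (var 0)))           ≈⟨ lamβη (η (var 0)) ⟩
  I                                         ∎
  where
  open import Relation.Binary.Reasoning.Setoid βη-setoid
  x₁Ix₀ : Term
  x₁Ix₀ = app (var 1) (app I (var 0))

ηid-selfInverse : ∀ p → compose (ηid p) (ηid p) =βη I
ηid-selfInverse p = begin
  compose (ηid p) (ηid p)                ≡⟨ cong (λ t → lam (app t (app t (var 0)))) (shift-Scoped (ηid-closed p)) ⟩
  lam (app (ηid p) (app (ηid p) (var 0))) ≈⟨ lamβη (appβη (ηid=βηI p) (appβη (ηid=βηI p) reflβη)) ⟩
  lam (app I (app I (var 0)))             ≈⟨ lamβη (β (var 0) (app I (var 0))) ⟩
  lam (app I (var 0))                     ≈⟨ lamβη (β (var 0) (var 0)) ⟩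
  I                                       ∎
  where open import Relation.Binary.Reasoning.Setoid βη-setoid

blank : Env → Env
blank []      = []
blank (_ ∷ Γ) = nothing ∷ blank Γ

blank-Empty : ∀ Γ → Empty (blank Γ)
blank-Empty []      = []
blank-Empty (_ ∷ Γ) = refl ∷ blank-Empty Γ

split-left : ∀ Γ → Split Γ Γ (blank Γ)
split-left []            = []
split-left (nothing ∷ Γ) = n∷ split-left Γ
split-left (just _ ∷ Γ)  = l∷ split-left Γ

split-right : ∀ Γ → Split Γ (blank Γ) Γ
split-right []            = []
split-right (nothing ∷ Γ) = n∷ split-right Γ
split-right (just _ ∷ Γ)  = r∷ split-right Γ

split-blank : ∀ Γ → Split (blank Γ) (blank Γ) (blank Γ)
split-blank []      = []
split-blank (_ ∷ Γ) = n∷ split-blank Γ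

pad : ℕ → Env → Env
pad k Γ = replicate k nothing ++ Γ

pad-nothing : ∀ k Γ → pad k (nothing ∷ Γ) ≡ nothing ∷ pad k Γ
pad-nothing zero    Γ = refl
pad-nothing (suc k) Γ = cong (nothing ∷_) (pad-nothing k Γ)

Only-pad : ∀ k {A E} → Empty E → Only k A (pad k (just A ∷ E))
Only-pad zero    e = here e
Only-pad (suc k) e = there (Only-pad k e)

Split-pad : ∀ k {Γ Γ₁ Γ₂} → Split Γ Γ₁ Γ₂ → Split (pad k Γ) (pad k Γ₁) (pad k Γ₂)
Split-pad zero    s = s
Split-pad (suc k) s = n∷ Split-pad k s

infix 4 _⊢↑_∶_ _⊑_ _⊑[_]_

-- h has type A in Γ also behind any number of fresh unused binders, as ηExpand places it.
_⊢↑_∶_ : Env → Term → Ty → Set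
Γ ⊢↑ h ∶ A = ∀ k → pad k Γ ⊢ shift k 0 h ∶ A

var₀-⊢↑ : ∀ {E A} → Empty E → just A ∷ E ⊢↑ var 0 ∶ A
var₀-⊢↑ e k = ax (Only-pad k e)

I-typed : ∀ {E A} → Empty E → E ⊢ I ∶ A ⇒ A
I-typed e = ⇒I (ax (here e))

_⊑_ : Ty → Ty → Set
A ⊑ B = ∀ {Γ M} → Γ ⊢ M ∶ A → Γ ⊢ M ∶ B

data _⊑[_]_ : Ty → DPath → Ty → Set where
  leaf : ∀ {A B} → A ⊑ B → A ⊑[ [] ] B
  ↙⇒   : ∀ {p A B R} → B ⊑[ p ] A → A ⇒ R ⊑[ ↙ ∷ p ] B ⇒ R
  ↘⇒   : ∀ {p A B R} → A ⊑[ p ] B → R ⇒ A ⊑[ ↘ ∷ p ] R ⇒ B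
  ∧⊑   : ∀ {p A B A′ B′} → A ⊑[ p ] B → A′ ⊑[ p ] B′ → A ∧ A′ ⊑[ p ] B ∧ B′
  ∨⊑   : ∀ {p A B A′ B′} → A ⊑[ p ] B → A′ ⊑[ p ] B′ → A ∨ A′ ⊑[ p ] B ∨ B′

mutual
  ηExpand-typed : ∀ {p A B Γ h} → A ⊑[ p ] B → Γ ⊢↑ h ∶ A → Γ ⊢ ηExpand p h ∶ B
  ηExpand-typed (leaf A⊑B) ⊢h = A⊑B (⊢h 0)
  ηExpand-typed {Γ = Γ} (↙⇒ B⊑A) ⊢h =
    ⇒I (⇒E (r∷ split-left Γ) (⊢h 1)
           (⇒E (r∷ split-blank Γ) (ηid-typed B⊑A (refl ∷ blank-Empty Γ)) (ax (here (blank-Empty Γ)))))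
  ηExpand-typed {↘ ∷ p} {R ⇒ A} {R ⇒ B} {Γ} {h} (↘⇒ A⊑B) ⊢h =
    ≡-subst (λ t → Γ ⊢ t ∶ R ⇒ B) (sym (ηExpand-↘ p h)) (⇒I (ηExpand-typed {h = hIx₀} A⊑B ⊢hIx₀))
    where
    hIx₀ : Term
    hIx₀ = app (shift 1 0 h) (app I (var 0))
    ⊢hIx₀ : just R ∷ Γ ⊢↑ hIx₀ ∶ A
    ⊢hIx₀ k rewrite shift-shift k 1 0 h =
      ⇒E (Split-pad k (r∷ split-left Γ))
         (≡-subst (λ E → E ⊢ shift (suc k) 0 h ∶ R ⇒ A) (sym (pad-nothing k Γ)) (⊢h (suc k)))
         (⇒E (split-right (pad k (just R ∷ blank Γ))) (I-typed (blank-Empty _)) (var₀-⊢↑ (blank-Empty Γ) k))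
  ηExpand-typed {h = h} (∧⊑ A⊑B A′⊑B′) ⊢h =
    ∧I (ηExpand-typed {h = h} A⊑B (λ k → ∧El (⊢h k))) (ηExpand-typed {h = h} A′⊑B′ (λ k → ∧Er (⊢h k)))
  -- Linearity forbids expanding h in two places; instead ∨E expands a variable in both
  -- branches and substitutes h once.  Its side conjunct θ is the disjunction itself.
  ηExpand-typed {p} {A ∨ A′} {B ∨ B′} {Γ} {h} (∨⊑ A⊑B A′⊑B′) ⊢h =
    ≡-subst (λ t → Γ ⊢ t ∶ B ∨ B′) (trans (subst-ηExpand p (shift 0 0 h)) (cong (ηExpand p) (shift-zero 0 h)))
      (∨E {θ = A ∨ A′} (split-right Γ)
        (∨Il (ηExpand-typed {h = var 0} A⊑B (λ k → ∧El (var₀-⊢↑ (blank-Empty Γ) k))))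
        (∨Ir (ηExpand-typed {h = var 0} A′⊑B′ (λ k → ∧El (var₀-⊢↑ (blank-Empty Γ) k))))
        (∧I (⊢h 0) (⊢h 0)))

  ηid-typed : ∀ {p A B E} → A ⊑[ p ] B → Empty E → E ⊢ ηid p ∶ A ⇒ B
  ηid-typed A⊑B e = ⇒I (ηExpand-typed A⊑B (var₀-⊢↑ e))

∨-⊑ : ∀ {A B R} → A ∧ (A ∨ B) ⊑ R → B ∧ (A ∨ B) ⊑ R → A ∨ B ⊑ R
∨-⊑ left right {Γ} ⊢M =
  ∨E (split-right Γ) (left (ax (here (blank-Empty Γ)))) (right (ax (here (blank-Empty Γ)))) (∧I ⊢M ⊢M)

BasicIso⇒⊑ : ∀ {σ τ} → BasicIso σ τ → σ ⊑ τ × τ ⊑ σ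
BasicIso⇒⊑ (idem∧ σ) = ∧El , λ ⊢M → ∧I ⊢M ⊢M
BasicIso⇒⊑ (idem∨ σ) = ∨-⊑ ∧El ∧El , ∨Il
BasicIso⇒⊑ (comm∧ σ τ) = swap , swap
  where
  swap : ∀ {A B} → A ∧ B ⊑ B ∧ A
  swap ⊢M = ∧I (∧Er ⊢M) (∧El ⊢M)
BasicIso⇒⊑ (comm∨ σ τ) = swap , swap
  where
  swap : ∀ {A B} → A ∨ B ⊑ B ∨ A
  swap = ∨-⊑ (λ ⊢M → ∨Ir (∧El ⊢M)) (λ ⊢M → ∨Il (∧El ⊢M))
BasicIso⇒⊑ (assoc∧ σ τ ρ) =
  (λ ⊢M → ∧I (∧El (∧El ⊢M)) (∧I (∧Er (∧El ⊢M)) (∧Er ⊢M))) ,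
  (λ ⊢M → ∧I (∧I (∧El ⊢M) (∧El (∧Er ⊢M))) (∧Er (∧Er ⊢M)))
BasicIso⇒⊑ (assoc∨ σ τ ρ) =
  ∨-⊑ (λ ⊢M → ∨-⊑ (λ ⊢N → ∨Il (∧El ⊢N)) (λ ⊢N → ∨Ir (∨Il (∧El ⊢N))) (∧El ⊢M))
      (λ ⊢M → ∨Ir (∨Ir (∧El ⊢M))) ,
  ∨-⊑ (λ ⊢M → ∨Il (∨Il (∧El ⊢M)))
      (λ ⊢M → ∨-⊑ (λ ⊢N → ∨Il (∨Ir (∧El ⊢N))) (λ ⊢N → ∨Ir (∧El ⊢N)) (∧El ⊢M))

Agrees⇒⊑-refl : ∀ {ρ p} → Agrees ρ p → ρ ⊑[ p ] ρ
Agrees⇒⊑-refl ε         = leaf (λ ⊢M → ⊢M)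
Agrees⇒⊑-refl (↙⇒ a)    = ↙⇒ (Agrees⇒⊑-refl a)
Agrees⇒⊑-refl (↘⇒ a)    = ↘⇒ (Agrees⇒⊑-refl a)
Agrees⇒⊑-refl (ag∧ a b) = ∧⊑ (Agrees⇒⊑-refl a) (Agrees⇒⊑-refl b)
Agrees⇒⊑-refl (ag∨ a b) = ∨⊑ (Agrees⇒⊑-refl a) (Agrees⇒⊑-refl b)

D⇒⊑[] : ∀ {σ τ C p} → σ ⊑ τ → τ ⊑ σ → D C p → C [ σ ] ⊑[ p ] C [ τ ]
D⇒⊑[] σ⊑τ τ⊑σ d□          = leaf σ⊑τ
D⇒⊑[] σ⊑τ τ⊑σ (d⇒ₗ dC)    = ↙⇒ (D⇒⊑[] τ⊑σ σ⊑τ dC)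
D⇒⊑[] σ⊑τ τ⊑σ (d⇒ᵣ dC)    = ↘⇒ (D⇒⊑[] σ⊑τ τ⊑σ dC)
D⇒⊑[] σ⊑τ τ⊑σ (d∧ₗ dC ag) = ∧⊑ (D⇒⊑[] σ⊑τ τ⊑σ dC) (Agrees⇒⊑-refl ag)
D⇒⊑[] σ⊑τ τ⊑σ (d∧ᵣ dC ag) = ∧⊑ (Agrees⇒⊑-refl ag) (D⇒⊑[] σ⊑τ τ⊑σ dC)
D⇒⊑[] σ⊑τ τ⊑σ (d∨ₗ dC ag) = ∨⊑ (D⇒⊑[] σ⊑τ τ⊑σ dC) (Agrees⇒⊑-refl ag)
D⇒⊑[] σ⊑τ τ⊑σ (d∨ᵣ dC ag) = ∨⊑ (Agrees⇒⊑-refl ag) (D⇒⊑[] σ⊑τ τ⊑σ dC)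

⊑[]⇒≈ : ∀ {p A B} → A ⊑[ p ] B → B ⊑[ p ] A → A ≈ B
⊑[]⇒≈ {p} A⊑B B⊑A =
  ηid p , ηid p , ηid-FHP p , ηid-FHP p , ηid-typed A⊑B [] , ηid-typed B⊑A [] ,
  ηid-selfInverse p , ηid-selfInverse p

mainTheorem20 : ∀ {σ τ} → BasicIso σ τ → (C : Ctx) →
    ∃ (λ p → D C p) → C [ σ ] ≈ C [ τ ]
mainTheorem20 iso C (p , dC) =
  let σ⊑τ , τ⊑σ = BasicIso⇒⊑ iso
  in ⊑[]⇒≈ (D⇒⊑[] σ⊑τ τ⊑σ dC) (D⇒⊑[] τ⊑σ σ⊑τ dC)
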